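{- Let $\mathcal{B}$ be the set of all blocking games, and let $\mathcal{P}(\mathcal{B})$ be the set of strictly $\mathscr{P}$-free elements of $\mathcal{B}$. Then $\mathcal{P}(\mathcal{B})$ is closed under disjunctive sum. Consequently, the set $\mathcal{P}_{\mathcal{B}}(\mathcal{B})$ of elements of $\mathcal{B}$ that are $\mathscr{P}$-free modulo $\mathcal{B}$ is also closed under disjunctive sum.
   Context: Games are short combinatorial game forms (no tombstones here) played under the misère convention: a player unable to move wins. The outcome $o(G)\in\{\mathscr{L},\mathscr{N},\mathscr{P},\mathscr{R}\}$: $\mathscr{L}$ if Left wins whoever starts, $\mathscr{R}$ if Right wins whoever starts, $\mathscr{N}$ if the first player wins, $\mathscr{P}$ if the second player wins. $G+H$ is the disjunctive sum. A subposition of $G$ is any game reachable from $G$ by a possibly empty, not necessarily alternating, sequence of moves (so $G$ is a subposition of itself). A game is strictly $\mathscr{P}$-free if none of its subpositions has outcome $\mathscr{P}$. For a set $\mathcal{A}$ of games, $G\geq_{\mathcal{A}}H$ means $o(G+X)\geq o(H+X)$ for all $X\in\mathcal{A}$ (outcomes ordered by $\mathscr{L}>\mathscr{N}>\mathscr{R}$, $\mathscr{L}>\mathscr{P}>\mathscr{R}$, with $\mathscr{N},\mathscr{P}$ incomparable), and $G\equiv_{\mathcal{A}}H$ means both $G\geq_{\mathcal{A}}H$ and $H\geq_{\mathcal{A}}G$. $\mathcal{P}_{\mathcal{A}}(\mathcal{A})$ is the set of $G\in\mathcal{A}$ for which there is a strictly $\mathscr{P}$-free $H\in\mathcal{A}$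 with $G\equiv_{\mathcal{A}}H$. A Left end is a game with no Left options (Right end symmetric). A Left end $X$ is blocked if for every Right option $X^R$ of $X$, either $X^R$ is a blocked Left end, or there is a Left option $X^{RL}$ of $X^R$ that is a blocked Left end; blocked Right ends are defined symmetrically. A game is blocking if every subposition that is a Left end is a blocked Left end and every subposition that is a Right end is a blocked Right end. $\mathcal{B}$ is the set of all blocking games. -}

module Defs where

open import Data.Bool using (Bool; true; false; not; _∨_)
open import Data.List using (List; []; _∷_; _++_)
open import Data.List.Membership.Propositional using (_∈_)
open import Data.List.Relation.Unary.Any using (Any)
open import Data.Product using (Σ; _×_; _,_)
open import Data.Sum using (_⊎_)
open import Relation.Binary.PropositionalEquality using (_≡_; _≢_)

data Game : Set where
  mk : List Game → List Game → Game

leftOpts : Game → List Game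
leftOpts (mk GL _) = GL

rightOpts : Game → List Game
rightOpts (mk _ GR) = GR

mutual
  infixl 6 _+_
  _+_ : Game → Game → Game
  G@(mk GL GR) + H@(mk HL HR) =
    mk (addL GL H ++ addR G HL) (addL GR H ++ addR G HR)

  addL : List Game → Game → List Game
  addL [] H = []
  addL (g ∷ gs) H = (g + H) ∷ addL gs H

  addR : Game → List Game → List Game
  addR G [] = []
  addR G (h ∷ hs) = (G + h) ∷ addR G hs

-- Misère play: lf G = Left wins G moving first; rf G = Right wins G moving first.
mutual
  lf : Game → Bool
  lf (mk [] _) = true
  lf (mk (g ∷ gs) _) = someNotRf (g ∷ gs)

  someNotRf : List Game → Bool
  someNotRf [] = false
  someNotRf (g ∷ gs) = not (rf g) ∨ someNotRf gs

  rf : Game → Bool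
  rf (mk _ []) = true
  rf (mk _ (g ∷ gs)) = someNotLf (g ∷ gs)

  someNotLf : List Game → Bool
  someNotLf [] = false
  someNotLf (g ∷ gs) = not (lf g) ∨ someNotLf gs

data Outcome : Set where
  𝓛 𝓝 𝓟 𝓡 : Outcome

outcomeOf : Bool → Bool → Outcome
outcomeOf true  false = 𝓛
outcomeOf true  true  = 𝓝
outcomeOf false false = 𝓟
outcomeOf false true  = 𝓡

outcome : Game → Outcome
outcome G = outcomeOf (lf G) (rf G)

data _≥o_ : Outcome → Outcome → Set where
  refl≥ : ∀ {o} → o ≥o o
  𝓛≥ : ∀ {o} → 𝓛 ≥o o
  ≥𝓡 : ∀ {o} → o ≥o 𝓡

-- Subpositions (reflexive, not necessarily alternating sequences of moves)
data _≼_ : Game → Game → Set where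
  here  : ∀ {G} → G ≼ G
  viaL  : ∀ {H G G'} → G' ∈ leftOpts G → H ≼ G' → H ≼ G
  viaR  : ∀ {H G G'} → G' ∈ rightOpts G → H ≼ G' → H ≼ G

StrictlyPFree : Game → Set
StrictlyPFree G = ∀ H → H ≼ G → outcome H ≢ 𝓟

data BlockedL : Game → Set where
  blockedL : ∀ {XR} →
    (∀ {Y} → Y ∈ XR → BlockedL Y ⊎ Any BlockedL (leftOpts Y)) →
    BlockedL (mk [] XR)

data BlockedR : Game → Set where
  blockedR : ∀ {XL} →
    (∀ {Y} → Y ∈ XL → BlockedR Y ⊎ Any BlockedR (rightOpts Y)) →
    BlockedR (mk XL [])

Blocking : Game → Set
Blocking G = ∀ H → H ≼ G →
  (leftOpts H ≡ [] → BlockedL H) × (rightOpts H ≡ [] → BlockedR H)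

_≥B_ : Game → Game → Set
G ≥B H = ∀ X → Blocking X → outcome (G + X) ≥o outcome (H + X)

_≡B_ : Game → Game → Set
G ≡B H = (G ≥B H) × (H ≥B G)

InPB : Game → Set
InPB G = Blocking G × StrictlyPFree G

InPBmodB : Game → Set
InPBmodB G = Blocking G × Σ Game (λ H → Blocking H × StrictlyPFree H × (G ≡B H))

-- Let n also denote the integer game in which Left (n ≥ 0) or Right (n < 0) has |n| free
-- moves. The heart of the proof is a cancellation lemma for X, Y in 𝒫(𝓑): if Left wins
-- X + n moving first and Y + (−n−1) moving second, she wins X + Y moving first; if she wins
-- both moving second, she wins X + Y moving second. Within it, blocking is needed only when X + n has no Left move: then X is a
-- blocked Left end, and adding such an end to a strictly 𝓟-free game keeps a first-move win
-- for Left.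
--
-- For G, H in 𝒫(𝓑), Left wins G + n moving first when n = −(size G) − 1 but not when
-- n > size G, so for some n she wins G + n but not G + (n+2). If Right loses H + (−n−1)
-- moving first, cancellation shows Left wins G + H moving first. Otherwise Left wins the
-- conjugate H̄ + (n+1) moving first, and she wins Ḡ + (−n−2) moving second, so cancellation
-- for the conjugates shows Right wins G + H moving first. In both cases G + H is not 𝓟, and
-- this holds for every subposition, since those are sums of subpositions of G and H.
-- Because 𝓑 is closed under sums, adding a blocking game preserves ≥ modulo 𝓑, and this
-- gives the second part.

module Submission where

open import Data.Bool using (Bool; true; false; not; _∨_)
open import Data.Bool.ListAction using (any)
open import Data.Bool.Properties using (∨-zeroʳ; ∨-conicalˡ; ∨-conicalʳ; not-injective)
open import Data.Empty using (⊥-elim)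
open import Data.Integer using (ℤ; -[1+_]; +0; +[1+_]; -_) renaming (+_ to pos)
import Data.Integer as ℤ
import Data.Integer.Properties as ℤ
open import Data.List using (List; []; _∷_; _++_; map; null)
open import Data.List.Membership.Propositional using (_∈_; _∉_)
open import Data.List.Membership.Propositional.Properties
  using (∈-map⁺; ∈-map⁻; ∈-++⁺ˡ; ∈-++⁺ʳ; ∈-++⁻)
open import Data.List.Properties using (++-conicalˡ; ++-conicalʳ)
open import Data.List.Relation.Unary.Any using (Any; here; there)
import Data.List.Relation.Unary.Any.Properties as Any
open import Data.Nat using (ℕ; zero; suc)
import Data.Nat as ℕ
import Data.Nat.Properties as ℕ
open import Data.Product using (_×_; _,_; ∃-syntax; proj₁; proj₂)
open import Data.Sum using (_⊎_; inj₁; inj₂)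
open import Function using (_∘_)
open import Induction.WellFounded using (Acc; acc; WellFounded)
open import Relation.Binary.PropositionalEquality using (_≡_; _≢_; refl; sym; trans; cong; cong₂; subst; subst₂)

open import Defs

∀∉⇒≡[] : ∀ {A : Set} {xs : List A} → (∀ {x} → x ∉ xs) → xs ≡ []
∀∉⇒≡[] {xs = []} _ = refl
∀∉⇒≡[] {xs = x ∷ xs} ∉ = ⊥-elim (∉ (here refl))

≡[]⇒∉ : ∀ {A : Set} {xs : List A} {x} → xs ≡ [] → x ∉ xs
≡[]⇒∉ refl ()

[]-or-∈ : ∀ {A : Set} (xs : List A) → xs ≡ [] ⊎ ∃[ x ] x ∈ xs
[]-or-∈ [] = inj₁ refl
[]-or-∈ (x ∷ xs) = inj₂ (x , here refl)

map≡[]⇒≡[] : ∀ {A B : Set} {f : A → B} xs → map f xs ≡ [] → xs ≡ []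
map≡[]⇒≡[] [] _ = refl

contraposeᵇ : ∀ {a b : Bool} → (a ≡ true → b ≡ true) → b ≡ false → a ≡ false
contraposeᵇ {false} _ _ = refl
contraposeᵇ {true} a⇒b b≡false with trans (sym (a⇒b refl)) b≡false
... | ()

any-not-true⇒ : ∀ {A : Set} (f : A → Bool) xs → any (not ∘ f) xs ≡ true
              → ∃[ x ] x ∈ xs × f x ≡ false
any-not-true⇒ f (x ∷ xs) h with f x in e
... | false = x , here refl , e
... | true = let y , y∈ , fy = any-not-true⇒ f xs h in y , there y∈ , fy

any-not-intro : ∀ {A : Set} (f : A → Bool) {x xs} → x ∈ xs → f x ≡ false → any (not ∘ f) xs ≡ true
any-not-intro f (here refl) e rewrite e = refl
any-not-intro f {xs = y ∷ _} (there p) e = trans (cong (not (f y) ∨_) (any-not-intro f p e)) (∨-zeroʳ _)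

any-not-false⇒ : ∀ {A : Set} (f : A → Bool) {x} xs → any (not ∘ f) xs ≡ false → x ∈ xs → f x ≡ true
any-not-false⇒ f (y ∷ xs) h (here refl) = not-injective (∨-conicalˡ _ _ h)
any-not-false⇒ f (y ∷ xs) h (there p) = any-not-false⇒ f xs (∨-conicalʳ _ _ h) p

any-not-false-intro : ∀ {A : Set} (f : A → Bool) xs → (∀ {x} → x ∈ xs → f x ≡ true)
                    → any (not ∘ f) xs ≡ false
any-not-false-intro f [] _ = refl
any-not-false-intro f (x ∷ xs) all rewrite all (here refl) = any-not-false-intro f xs (all ∘ there)

data Side : Set where
  left right : Side

opp : Side → Side
opp left = right
opp right = left

options : Side → Game → List Game
options left = leftOpts
options right = rightOpts

addL≡map : ∀ gs H → addL gs H ≡ map (_+ H) gs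
addL≡map [] H = refl
addL≡map (g ∷ gs) H = cong (g + H ∷_) (addL≡map gs H)

addR≡map : ∀ G hs → addR G hs ≡ map (G +_) hs
addR≡map G [] = refl
addR≡map G (h ∷ hs) = cong (G + h ∷_) (addR≡map G hs)

options-+ : ∀ s G H → options s (G + H) ≡ map (_+ H) (options s G) ++ map (G +_) (options s H)
options-+ left G@(mk GL _) H@(mk HL _) = cong₂ _++_ (addL≡map GL H) (addR≡map G HL)
options-+ right G@(mk _ GR) H@(mk _ HR) = cong₂ _++_ (addL≡map GR H) (addR≡map G HR)

∈-+⁺ˡ : ∀ s G H {g} → g ∈ options s G → g + H ∈ options s (G + H)
∈-+⁺ˡ s G H p rewrite options-+ s G H = ∈-++⁺ˡ (∈-map⁺ (_+ H) p)

∈-+⁺ʳ : ∀ s G H {h} → h ∈ options s H → G + h ∈ options s (G + H)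
∈-+⁺ʳ s G H p rewrite options-+ s G H = ∈-++⁺ʳ (map (_+ H) (options s G)) (∈-map⁺ (G +_) p)

data OptionOfSum (s : Side) (G H : Game) : Game → Set where
  optionˡ : ∀ {g} → g ∈ options s G → OptionOfSum s G H (g + H)
  optionʳ : ∀ {h} → h ∈ options s H → OptionOfSum s G H (G + h)

∈-+⁻ : ∀ s G H {x} → x ∈ options s (G + H) → OptionOfSum s G H x
∈-+⁻ s G H p rewrite options-+ s G H with ∈-++⁻ (map (_+ H) (options s G)) p
... | inj₁ q with ∈-map⁻ (_+ H) q
...   | _ , g∈ , refl = optionˡ g∈
∈-+⁻ s G H p | inj₂ q with ∈-map⁻ (G +_) q
...   | _ , h∈ , refl = optionʳ h∈

any-+⁺ˡ : ∀ s {P : Game → Set} G H → Any (λ g → P (g + H)) (options s G) → Any P (options s (G + H))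
any-+⁺ˡ s {P} G H a = subst (Any P) (sym (options-+ s G H)) (Any.++⁺ˡ (Any.map⁺ a))

any-+⁺ʳ : ∀ s {P : Game → Set} G H → Any (λ h → P (G + h)) (options s H) → Any P (options s (G + H))
any-+⁺ʳ s {P} G H a = subst (Any P) (sym (options-+ s G H)) (Any.++⁺ʳ (map (_+ H) (options s G)) (Any.map⁺ a))

+-end : ∀ s G H → options s G ≡ [] → options s H ≡ [] → options s (G + H) ≡ []
+-end s G H eG eH rewrite options-+ s G H | eG | eH = refl

+-end⁻ˡ : ∀ s G H → options s (G + H) ≡ [] → options s G ≡ []
+-end⁻ˡ s G H e = map≡[]⇒≡[] _ (++-conicalˡ _ _ (trans (sym (options-+ s G H)) e))

+-end⁻ʳ : ∀ s G H → options s (G + H) ≡ [] → options s H ≡ []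
+-end⁻ʳ s G H e = map≡[]⇒≡[] _ (++-conicalʳ (map (_+ H) (options s G)) _ (trans (sym (options-+ s G H)) e))

-- Misère outcomes

first : Side → Game → Bool
first left = lf
first right = rf

someNotRf≡any : ∀ L → someNotRf L ≡ any (not ∘ rf) L
someNotRf≡any [] = refl
someNotRf≡any (g ∷ L) = cong (not (rf g) ∨_) (someNotRf≡any L)

someNotLf≡any : ∀ L → someNotLf L ≡ any (not ∘ lf) L
someNotLf≡any [] = refl
someNotLf≡any (g ∷ L) = cong (not (lf g) ∨_) (someNotLf≡any L)

first≡ : ∀ s G → first s G ≡ null (options s G) ∨ any (not ∘ first (opp s)) (options s G)
first≡ left (mk [] _) = refl
first≡ left (mk (g ∷ L) _) = someNotRf≡any (g ∷ L)
first≡ right (mk _ []) = refl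
first≡ right (mk _ (g ∷ R)) = someNotLf≡any (g ∷ R)

first-end : ∀ s G → options s G ≡ [] → first s G ≡ true
first-end s G e rewrite first≡ s G | e = refl

first-move : ∀ s G {g} → g ∈ options s G → first (opp s) g ≡ false → first s G ≡ true
first-move s G p q rewrite first≡ s G =
  trans (cong (null (options s G) ∨_) (any-not-intro (first (opp s)) p q)) (∨-zeroʳ _)

data FirstWin (s : Side) (G : Game) : Set where
  end  : options s G ≡ [] → FirstWin s G
  move : ∀ {g} → g ∈ options s G → first (opp s) g ≡ false → FirstWin s G

first-true⇒ : ∀ s G → first s G ≡ true → FirstWin s G
first-true⇒ s G h with options s G in e | trans (sym (first≡ s G)) h
... | [] | _ = end e
... | g ∷ L | h′ with any-not-true⇒ (first (opp s)) (g ∷ L) h′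
...   | x , x∈ , fx = move (subst (x ∈_) (sym e) x∈) fx

first-false⇒ : ∀ s G {g} → first s G ≡ false → g ∈ options s G → first (opp s) g ≡ true
first-false⇒ s G h p =
  any-not-false⇒ (first (opp s)) (options s G) (∨-conicalʳ _ _ (trans (sym (first≡ s G)) h)) p

first-false⇒nonempty : ∀ s G → first s G ≡ false → options s G ≢ []
first-false⇒nonempty s G h e with trans (sym (first-end s G e)) h
... | ()

first-false-intro : ∀ s G → options s G ≢ [] → (∀ {g} → g ∈ options s G → first (opp s) g ≡ true)
                  → first s G ≡ false
first-false-intro s G ne all rewrite first≡ s G with options s G in e
... | [] = ⊥-elim (ne refl)
... | g ∷ L = any-not-false-intro (first (opp s)) (g ∷ L) all

outcome≡𝓟 : ∀ G → lf G ≡ false → rf G ≡ false → outcome G ≡ 𝓟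
outcome≡𝓟 G l r rewrite l | r = refl

outcome≢𝓟 : ∀ G → lf G ≡ true ⊎ rf G ≡ true → outcome G ≢ 𝓟
outcome≢𝓟 G (inj₁ l) rewrite l with rf G
... | true = λ ()
... | false = λ ()
outcome≢𝓟 G (inj₂ r) rewrite r with lf G
... | true = λ ()
... | false = λ ()

StrictlyPFree⇒lf : ∀ {G} → StrictlyPFree G → rf G ≡ false → lf G ≡ true
StrictlyPFree⇒lf {G} free r with lf G in l
... | true = refl
... | false = ⊥-elim (free G here (outcome≡𝓟 G l r))

-- Isomorphism of game trees

_⊏_ : Game → Game → Set
g ⊏ G = ∃[ s ] g ∈ options s G

mutual
  ⊏-wellFounded : WellFounded _⊏_
  ⊏-wellFounded (mk L R) = acc λ { (left , p) → ∈⇒acc L p ; (right , p) → ∈⇒acc R p }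

  ∈⇒acc : ∀ L {g} → g ∈ L → Acc _⊏_ g
  ∈⇒acc (x ∷ L) (here refl) = ⊏-wellFounded x
  ∈⇒acc (x ∷ L) (there p) = ∈⇒acc L p

infix 4 _≅_

-- Sums of game forms are commutative and associative only up to the order of options.
data _≅_ (A B : Game) : Set where
  iso : (∀ s {a} → a ∈ options s A → ∃[ b ] b ∈ options s B × a ≅ b)
      → (∀ s {b} → b ∈ options s B → ∃[ a ] a ∈ options s A × a ≅ b)
      → A ≅ B

≅-refl : ∀ G → G ≅ G
≅-refl G = go (⊏-wellFounded G)
  where
  go : ∀ {G} → Acc _⊏_ G → G ≅ G
  go (acc rs) = iso (λ s p → _ , p , go (rs (s , p))) (λ s p → _ , p , go (rs (s , p)))

mutual
  +-cong : ∀ {A A′ B B′} → A ≅ A′ → B ≅ B′ → A + B ≅ A′ + B′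
  +-cong A≅A′ B≅B′ =
    iso (λ s p → +-cong-forth s A≅A′ B≅B′ (∈-+⁻ s _ _ p))
        (λ s p → +-cong-back s A≅A′ B≅B′ (∈-+⁻ s _ _ p))

  +-cong-forth : ∀ s {A A′ B B′ x} → A ≅ A′ → B ≅ B′ → OptionOfSum s A B x
               → ∃[ y ] y ∈ options s (A′ + B′) × x ≅ y
  +-cong-forth s (iso f _) B≅B′ (optionˡ q) with f s q
  ... | _ , q′ , a≅a′ = _ , ∈-+⁺ˡ s _ _ q′ , +-cong a≅a′ B≅B′
  +-cong-forth s A≅A′ (iso g _) (optionʳ q) with g s q
  ... | _ , q′ , b≅b′ = _ , ∈-+⁺ʳ s _ _ q′ , +-cong A≅A′ b≅b′

  +-cong-back : ∀ s {A A′ B B′ y} → A ≅ A′ → B ≅ B′ → OptionOfSum s A′ B′ y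
              → ∃[ x ] x ∈ options s (A + B) × x ≅ y
  +-cong-back s (iso _ f⁻) B≅B′ (optionˡ q) with f⁻ s q
  ... | _ , q′ , a≅a′ = _ , ∈-+⁺ˡ s _ _ q′ , +-cong a≅a′ B≅B′
  +-cong-back s A≅A′ (iso _ g⁻) (optionʳ q) with g⁻ s q
  ... | _ , q′ , b≅b′ = _ , ∈-+⁺ʳ s _ _ q′ , +-cong A≅A′ b≅b′

+-comm-≅ : ∀ A B → A + B ≅ B + A
+-comm-≅ A B = go (⊏-wellFounded A) (⊏-wellFounded B)
  where
  go : ∀ {A B} → Acc _⊏_ A → Acc _⊏_ B → A + B ≅ B + A
  go {A} {B} accA@(acc rsA) accB@(acc rsB) = iso forth back
    where
    forth : ∀ s {x} → x ∈ options s (A + B) → ∃[ y ] y ∈ options s (B + A) × x ≅ y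
    forth s p with ∈-+⁻ s A B p
    ... | optionˡ q = _ , ∈-+⁺ʳ s B A q , go (rsA (s , q)) accB
    ... | optionʳ q = _ , ∈-+⁺ˡ s B A q , go accA (rsB (s , q))
    back : ∀ s {y} → y ∈ options s (B + A) → ∃[ x ] x ∈ options s (A + B) × x ≅ y
    back s p with ∈-+⁻ s B A p
    ... | optionˡ q = _ , ∈-+⁺ʳ s A B q , go accA (rsB (s , q))
    ... | optionʳ q = _ , ∈-+⁺ˡ s A B q , go (rsA (s , q)) accB

+-assoc-≅ : ∀ A B C → (A + B) + C ≅ A + (B + C)
+-assoc-≅ A B C = go (⊏-wellFounded A) (⊏-wellFounded B) (⊏-wellFounded C)
  where
  go : ∀ {A B C} → Acc _⊏_ A → Acc _⊏_ B → Acc _⊏_ C → (A + B) + C ≅ A + (B + C)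
  go {A} {B} {C} accA@(acc rsA) accB@(acc rsB) accC@(acc rsC) = iso forth back
    where
    forth : ∀ s {x} → x ∈ options s ((A + B) + C) → ∃[ y ] y ∈ options s (A + (B + C)) × x ≅ y
    forth s p with ∈-+⁻ s (A + B) C p
    ... | optionʳ q = _ , ∈-+⁺ʳ s A (B + C) (∈-+⁺ʳ s B C q) , go accA accB (rsC (s , q))
    ... | optionˡ q with ∈-+⁻ s A B q
    ...   | optionˡ r = _ , ∈-+⁺ˡ s A (B + C) r , go (rsA (s , r)) accB accC
    ...   | optionʳ r = _ , ∈-+⁺ʳ s A (B + C) (∈-+⁺ˡ s B C r) , go accA (rsB (s , r)) accC
    back : ∀ s {y} → y ∈ options s (A + (B + C)) → ∃[ x ] x ∈ options s ((A + B) + C) × x ≅ y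
    back s p with ∈-+⁻ s A (B + C) p
    ... | optionˡ q = _ , ∈-+⁺ˡ s (A + B) C (∈-+⁺ˡ s A B q) , go (rsA (s , q)) accB accC
    ... | optionʳ q with ∈-+⁻ s B C q
    ...   | optionˡ r = _ , ∈-+⁺ˡ s (A + B) C (∈-+⁺ʳ s A B r) , go accA (rsB (s , r)) accC
    ...   | optionʳ r = _ , ∈-+⁺ʳ s (A + B) C r , go accA accB (rsC (s , r))

mutual
  first-true-≅ : ∀ s {A B} → A ≅ B → first s A ≡ true → first s B ≡ true
  first-true-≅ s {A} {B} (iso forth back) h with first-true⇒ s A h
  ... | end e = first-end s B (∀∉⇒≡[] λ p → ≡[]⇒∉ e (proj₁ (proj₂ (back s p))))
  ... | move p q with forth s p
  ...   | _ , p′ , a≅b = first-move s B p′ (contraposeᵇ (first-true-≅˘ (opp s) a≅b) q)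

  first-true-≅˘ : ∀ s {A B} → A ≅ B → first s B ≡ true → first s A ≡ true
  first-true-≅˘ s {A} {B} (iso forth back) h with first-true⇒ s B h
  ... | end e = first-end s A (∀∉⇒≡[] λ p → ≡[]⇒∉ e (proj₁ (proj₂ (forth s p))))
  ... | move p q with back s p
  ...   | _ , p′ , a≅b = first-move s A p′ (contraposeᵇ (first-true-≅ (opp s) a≅b) q)

first-≅ : ∀ s {A B} → A ≅ B → first s A ≡ first s B
first-≅ s {A} A≅B with first s A in e
... | true = sym (first-true-≅ s A≅B e)
... | false = sym (contraposeᵇ (first-true-≅˘ s A≅B) e)

outcome-≅ : ∀ {A B} → A ≅ B → outcome A ≡ outcome B
outcome-≅ A≅B = cong₂ outcomeOf (first-≅ left A≅B) (first-≅ right A≅B)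

first-+-comm : ∀ s G H → first s (G + H) ≡ first s (H + G)
first-+-comm s G H = first-≅ s (+-comm-≅ G H)

-- Conjugates

mutual
  conj : Game → Game
  conj (mk L R) = mk (conjL R) (conjL L)

  conjL : List Game → List Game
  conjL [] = []
  conjL (G ∷ Gs) = conj G ∷ conjL Gs

conjL≡map : ∀ Gs → conjL Gs ≡ map conj Gs
conjL≡map [] = refl
conjL≡map (G ∷ Gs) = cong (conj G ∷_) (conjL≡map Gs)

conjL-++ : ∀ Gs Hs → conjL (Gs ++ Hs) ≡ conjL Gs ++ conjL Hs
conjL-++ [] Hs = refl
conjL-++ (G ∷ Gs) Hs = cong (conj G ∷_) (conjL-++ Gs Hs)

options-conj : ∀ s G → options s (conj G) ≡ conjL (options (opp s) G)
options-conj left (mk L R) = refl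
options-conj right (mk L R) = refl

∈-conj⁻ : ∀ s {x} G → x ∈ options s (conj G) → ∃[ g ] g ∈ options (opp s) G × x ≡ conj g
∈-conj⁻ s G p rewrite options-conj s G | conjL≡map (options (opp s) G) = ∈-map⁻ conj p

conj-end⁻ : ∀ s G → options s (conj G) ≡ [] → options (opp s) G ≡ []
conj-end⁻ s G e = map≡[]⇒≡[] _ (trans (sym (conjL≡map _)) (trans (sym (options-conj s G)) e))

mutual
  conj-involutive : ∀ G → conj (conj G) ≡ G
  conj-involutive (mk L R) = cong₂ mk (conjL-involutive L) (conjL-involutive R)

  conjL-involutive : ∀ Gs → conjL (conjL Gs) ≡ Gs
  conjL-involutive [] = refl
  conjL-involutive (G ∷ Gs) = cong₂ _∷_ (conj-involutive G) (conjL-involutive Gs)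

mutual
  conj-+ : ∀ G H → conj (G + H) ≡ conj G + conj H
  conj-+ G@(mk GL GR) H@(mk HL HR) =
    cong₂ mk (trans (conjL-++ (addL GR H) (addR G HR)) (cong₂ _++_ (conj-addL GR H) (conj-addR G HR)))
             (trans (conjL-++ (addL GL H) (addR G HL)) (cong₂ _++_ (conj-addL GL H) (conj-addR G HL)))

  conj-addL : ∀ Gs H → conjL (addL Gs H) ≡ addL (conjL Gs) (conj H)
  conj-addL [] H = refl
  conj-addL (G ∷ Gs) H = cong₂ _∷_ (conj-+ G H) (conj-addL Gs H)

  conj-addR : ∀ G Hs → conjL (addR G Hs) ≡ addR (conj G) (conjL Hs)
  conj-addR G [] = refl
  conj-addR G (H ∷ Hs) = cong₂ _∷_ (conj-+ G H) (conj-addR G Hs)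

mutual
  lf-conj : ∀ G → lf (conj G) ≡ rf G
  lf-conj (mk L []) = refl
  lf-conj (mk L (G ∷ R)) = someNotRf-conjL (G ∷ R)

  rf-conj : ∀ G → rf (conj G) ≡ lf G
  rf-conj (mk [] R) = refl
  rf-conj (mk (G ∷ L) R) = someNotLf-conjL (G ∷ L)

  someNotRf-conjL : ∀ Gs → someNotRf (conjL Gs) ≡ someNotLf Gs
  someNotRf-conjL [] = refl
  someNotRf-conjL (G ∷ Gs) = cong₂ (λ b c → not b ∨ c) (rf-conj G) (someNotRf-conjL Gs)

  someNotLf-conjL : ∀ Gs → someNotLf (conjL Gs) ≡ someNotRf Gs
  someNotLf-conjL [] = refl
  someNotLf-conjL (G ∷ Gs) = cong₂ (λ b c → not b ∨ c) (lf-conj G) (someNotLf-conjL Gs)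

first-conj : ∀ s G → first s (conj G) ≡ first (opp s) G
first-conj left = lf-conj
first-conj right = rf-conj

first-conj-+ : ∀ s G H → first s (conj G + conj H) ≡ first (opp s) (G + H)
first-conj-+ s G H = trans (cong (first s) (sym (conj-+ G H))) (first-conj s (G + H))

conj-𝓟 : ∀ G → outcome (conj G) ≡ 𝓟 → outcome G ≡ 𝓟
conj-𝓟 G o with lf G in l | rf G in r
... | false | false = refl
... | true | _ = ⊥-elim (outcome≢𝓟 (conj G) (inj₂ (trans (rf-conj G) l)) o)
... | _ | true = ⊥-elim (outcome≢𝓟 (conj G) (inj₁ (trans (lf-conj G) r)) o)

-- Subpositions and blocking

via : ∀ s {H G g} → g ∈ options s G → H ≼ g → H ≼ G
via left = viaL
via right = viaR

≼-trans : ∀ {A B C} → A ≼ B → B ≼ C → A ≼ C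
≼-trans p here = p
≼-trans p (viaL q r) = viaL q (≼-trans p r)
≼-trans p (viaR q r) = viaR q (≼-trans p r)

data SumOfSubpositions (G H : Game) : Game → Set where
  _⊕_ : ∀ {a b} → a ≼ G → b ≼ H → SumOfSubpositions G H (a + b)

mutual
  ≼-+⁻ : ∀ {S G H} → S ≼ (G + H) → SumOfSubpositions G H S
  ≼-+⁻ here = here ⊕ here
  ≼-+⁻ {G = G} {H} (viaL p r) = ≼-+⁻-via left (∈-+⁻ left G H p) r
  ≼-+⁻ {G = G} {H} (viaR p r) = ≼-+⁻-via right (∈-+⁻ right G H p) r

  ≼-+⁻-via : ∀ s {S G H x} → OptionOfSum s G H x → S ≼ x → SumOfSubpositions G H S
  ≼-+⁻-via s (optionˡ q) r with ≼-+⁻ r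
  ... | a ⊕ b = via s q a ⊕ b
  ≼-+⁻-via s (optionʳ q) r with ≼-+⁻ r
  ... | a ⊕ b = a ⊕ via s q b

mutual
  ≼-conj⁻ : ∀ {S G} → S ≼ conj G → ∃[ S′ ] S′ ≼ G × S ≡ conj S′
  ≼-conj⁻ here = _ , here , refl
  ≼-conj⁻ {G = G} (viaL p r) = ≼-conj⁻-via left G p r
  ≼-conj⁻ {G = G} (viaR p r) = ≼-conj⁻-via right G p r

  ≼-conj⁻-via : ∀ s {S x} G → x ∈ options s (conj G) → S ≼ x → ∃[ S′ ] S′ ≼ G × S ≡ conj S′
  ≼-conj⁻-via s G p r with ∈-conj⁻ s G p
  ... | g , q , refl with ≼-conj⁻ r
  ...   | S′ , S′≼g , S≡ = S′ , via (opp s) q S′≼g , S≡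

mutual
  +-blockedL : ∀ {G H} → BlockedL G → BlockedL H → BlockedL (G + H)
  +-blockedL {mk [] GR} {mk [] HR} bG bH =
    blockedL (λ p → +-blockedL-option bG bH (∈-+⁻ right (mk [] GR) (mk [] HR) p))

  +-blockedL-option : ∀ {G H Y} → BlockedL G → BlockedL H → OptionOfSum right G H Y
                    → BlockedL Y ⊎ Any BlockedL (leftOpts Y)
  +-blockedL-option {H = H} (blockedL f) bH (optionˡ {g} q) with f q
  ... | inj₁ b = inj₁ (+-blockedL b bH)
  ... | inj₂ a = inj₂ (any-+⁺ˡ left g H (+-blockedL-anyˡ a bH))
  +-blockedL-option {G = G} bG (blockedL g) (optionʳ {h} q) with g q
  ... | inj₁ b = inj₁ (+-blockedL bG b)
  ... | inj₂ a = inj₂ (any-+⁺ʳ left G h (+-blockedL-anyʳ bG a))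

  +-blockedL-anyˡ : ∀ {Gs H} → Any BlockedL Gs → BlockedL H → Any (λ g → BlockedL (g + H)) Gs
  +-blockedL-anyˡ (here b) bH = here (+-blockedL b bH)
  +-blockedL-anyˡ (there a) bH = there (+-blockedL-anyˡ a bH)

  +-blockedL-anyʳ : ∀ {G Hs} → BlockedL G → Any BlockedL Hs → Any (λ h → BlockedL (G + h)) Hs
  +-blockedL-anyʳ bG (here b) = here (+-blockedL bG b)
  +-blockedL-anyʳ bG (there a) = there (+-blockedL-anyʳ bG a)

mutual
  conj-blockedL : ∀ {X} → BlockedL X → BlockedR (conj X)
  conj-blockedL {mk [] XR} bX = blockedR (conj-blockedL-option bX)

  conj-blockedL-option : ∀ {XR Y} → BlockedL (mk [] XR) → Y ∈ conjL XR
                       → BlockedR Y ⊎ Any BlockedR (rightOpts Y)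
  conj-blockedL-option {XR} (blockedL f) p with ∈-conj⁻ left (mk [] XR) p
  ... | y , q , refl with f q
  ...   | inj₁ b = inj₁ (conj-blockedL b)
  ...   | inj₂ a = inj₂ (subst (Any BlockedR) (sym (options-conj right y)) (conj-blockedL-any a))

  conj-blockedL-any : ∀ {Gs} → Any BlockedL Gs → Any BlockedR (conjL Gs)
  conj-blockedL-any (here b) = here (conj-blockedL b)
  conj-blockedL-any (there a) = there (conj-blockedL-any a)

mutual
  conj-blockedR : ∀ {X} → BlockedR X → BlockedL (conj X)
  conj-blockedR {mk XL []} bX = blockedL (conj-blockedR-option bX)

  conj-blockedR-option : ∀ {XL Y} → BlockedR (mk XL []) → Y ∈ conjL XL
                       → BlockedL Y ⊎ Any BlockedL (leftOpts Y)
  conj-blockedR-option {XL} (blockedR f) p with ∈-conj⁻ right (mk XL []) p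
  ... | y , q , refl with f q
  ...   | inj₁ b = inj₁ (conj-blockedR b)
  ...   | inj₂ a = inj₂ (subst (Any BlockedL) (sym (options-conj left y)) (conj-blockedR-any a))

  conj-blockedR-any : ∀ {Gs} → Any BlockedR Gs → Any BlockedL (conjL Gs)
  conj-blockedR-any (here b) = here (conj-blockedR b)
  conj-blockedR-any (there a) = there (conj-blockedR-any a)

+-blockedR : ∀ {G H} → BlockedR G → BlockedR H → BlockedR (G + H)
+-blockedR {G} {H} bG bH =
  subst BlockedR conj-conj-+ (conj-blockedL (+-blockedL (conj-blockedR bG) (conj-blockedR bH)))
  where
  conj-conj-+ : conj (conj G + conj H) ≡ G + H
  conj-conj-+ = trans (conj-+ (conj G) (conj H)) (cong₂ _+_ (conj-involutive G) (conj-involutive H))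

Blocking-+ : ∀ {G H} → Blocking G → Blocking H → Blocking (G + H)
Blocking-+ bG bH S p with ≼-+⁻ p
... | _⊕_ {a} {b} a≼G b≼H =
  (λ e → +-blockedL (proj₁ (bG a a≼G) (+-end⁻ˡ left a b e)) (proj₁ (bH b b≼H) (+-end⁻ʳ left a b e))) ,
  (λ e → +-blockedR (proj₂ (bG a a≼G) (+-end⁻ˡ right a b e)) (proj₂ (bH b b≼H) (+-end⁻ʳ right a b e)))

Blocking-conj : ∀ {G} → Blocking G → Blocking (conj G)
Blocking-conj bG S p with ≼-conj⁻ p
... | S′ , S′≼G , refl =
  (λ e → conj-blockedR (proj₂ (bG S′ S′≼G) (conj-end⁻ left S′ e))) ,
  (λ e → conj-blockedL (proj₁ (bG S′ S′≼G) (conj-end⁻ right S′ e)))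

StrictlyPFree-option : ∀ s {g G} → StrictlyPFree G → g ∈ options s G → StrictlyPFree g
StrictlyPFree-option s free p K K≼g = free K (via s p K≼g)

InPB-≼ : ∀ {G H} → InPB G → H ≼ G → InPB H
InPB-≼ (bG , fG) H≼G = (λ K K≼H → bG K (≼-trans K≼H H≼G)) , (λ K K≼H → fG K (≼-trans K≼H H≼G))

InPB-option : ∀ s {g G} → InPB G → g ∈ options s G → InPB g
InPB-option s pG p = InPB-≼ pG (via s p here)

InPB-conj : ∀ {G} → InPB G → InPB (conj G)
InPB-conj (bG , fG) = Blocking-conj bG , free
  where
  free : StrictlyPFree (conj _)
  free S p with ≼-conj⁻ p
  ... | S′ , S′≼G , refl = λ o → fG S′ S′≼G (conj-𝓟 S′ o)

-- Integers

mutual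
  size : Game → ℕ
  size (mk L R) = suc (sizeL L ℕ.+ sizeL R)

  sizeL : List Game → ℕ
  sizeL [] = 0
  sizeL (G ∷ Gs) = size G ℕ.+ sizeL Gs

size-∈ : ∀ {G} Gs → G ∈ Gs → size G ℕ.≤ sizeL Gs
size-∈ (G ∷ Gs) (here refl) = ℕ.m≤m+n (size G) (sizeL Gs)
size-∈ (H ∷ Gs) (there p) = ℕ.≤-trans (size-∈ Gs p) (ℕ.m≤n+m (sizeL Gs) (size H))

size-option : ∀ s {g} G → g ∈ options s G → size g ℕ.< size G
size-option left (mk L R) p = ℕ.s≤s (ℕ.≤-trans (size-∈ L p) (ℕ.m≤m+n (sizeL L) (sizeL R)))
size-option right (mk L R) p = ℕ.s≤s (ℕ.≤-trans (size-∈ R p) (ℕ.m≤n+m (sizeL R) (sizeL L)))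

mutual
  size-conj : ∀ G → size (conj G) ≡ size G
  size-conj (mk L R) =
    cong suc (trans (cong₂ ℕ._+_ (sizeL-conjL R) (sizeL-conjL L)) (ℕ.+-comm (sizeL R) (sizeL L)))

  sizeL-conjL : ∀ Gs → sizeL (conjL Gs) ≡ sizeL Gs
  sizeL-conjL [] = refl
  sizeL-conjL (G ∷ Gs) = cong₂ ℕ._+_ (size-conj G) (sizeL-conjL Gs)

nat : ℕ → Game
nat zero = mk [] []
nat (suc k) = mk (nat k ∷ []) []

int : ℤ → Game
int (pos k) = nat k
int -[1+ k ] = conj (nat (suc k))

nat-rightEnd : ∀ k → rightOpts (nat k) ≡ []
nat-rightEnd zero = refl
nat-rightEnd (suc k) = refl

nat-leftEnd⁻ : ∀ k → leftOpts (nat k) ≡ [] → k ≡ 0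
nat-leftEnd⁻ zero _ = refl

nat-leftOption : ∀ {h} k → h ∈ leftOpts (nat k) → ∃[ k′ ] k ≡ suc k′ × h ≡ nat k′
nat-leftOption (suc k) (here refl) = k , refl , refl

conj-int : ∀ n → conj (int n) ≡ int (- n)
conj-int +0 = refl
conj-int +[1+ k ] = refl
conj-int -[1+ k ] = conj-involutive (nat (suc k))

mirror : ℤ → ℤ
mirror (pos k) = -[1+ k ]
mirror -[1+ k ] = pos k

mirror≡-suc : ∀ n → mirror n ≡ - ℤ.suc n
mirror≡-suc (pos k) = refl
mirror≡-suc -[1+ zero ] = refl
mirror≡-suc -[1+ suc k ] = refl

conj-int-mirror : ∀ n → conj (int (mirror n)) ≡ int (ℤ.suc n)
conj-int-mirror n =
  trans (conj-int (mirror n)) (cong int (trans (cong -_ (mirror≡-suc n)) (ℤ.neg-involutive (ℤ.suc n))))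

int-mirror-suc : ∀ n → int (mirror (ℤ.suc n)) ≡ conj (int (ℤ.suc (ℤ.suc n)))
int-mirror-suc n = trans (cong int (mirror≡-suc (ℤ.suc n))) (sym (conj-int (ℤ.suc (ℤ.suc n))))

mutual
  rf-+-nat-large : ∀ {G} k → Acc _⊏_ G → size G ℕ.≤ k → rf (G + nat k) ≡ true
  rf-+-nat-large {G} k (acc rs) G≤k with []-or-∈ (rightOpts G)
  ... | inj₁ e = first-end right (G + nat k) (+-end right G (nat k) e (nat-rightEnd k))
  ... | inj₂ (g , p) =
    first-move right (G + nat k) (∈-+⁺ˡ right G (nat k) p)
      (lf-+-nat-large k (rs (right , p)) (ℕ.<-≤-trans (size-option right G p) G≤k))

  lf-+-nat-large : ∀ {G} k → Acc _⊏_ G → size G ℕ.< k → lf (G + nat k) ≡ false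
  lf-+-nat-large {G} (suc k) accG@(acc rs) (ℕ.s≤s G≤k) =
    first-false-intro left (G + nat (suc k)) nonempty (λ p → all (∈-+⁻ left G (nat (suc k)) p))
    where
    nonempty : leftOpts (G + nat (suc k)) ≢ []
    nonempty e with +-end⁻ʳ left G (nat (suc k)) e
    ... | ()
    all : ∀ {x} → OptionOfSum left G (nat (suc k)) x → rf x ≡ true
    all (optionˡ p) =
      rf-+-nat-large (suc k) (rs (left , p))
        (ℕ.<⇒≤ (ℕ.<-≤-trans (size-option left G p) (ℕ.m≤n⇒m≤1+n G≤k)))
    all (optionʳ (here refl)) = rf-+-nat-large k accG G≤k

lf-+-conj-nat-large : ∀ {G} k → size G ℕ.≤ k → lf (G + conj (nat k)) ≡ true
lf-+-conj-nat-large {G} k G≤k =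
  trans (cong (λ X → lf (X + conj (nat k))) (sym (conj-involutive G)))
    (trans (first-conj-+ left (conj G) (nat k))
      (rf-+-nat-large k (⊏-wellFounded (conj G)) (subst (ℕ._≤ k) (sym (size-conj G)) G≤k)))

-- Cancellation

mutual
  lf-+-nat⇒lf : ∀ {Y} k → Acc _⊏_ Y → StrictlyPFree Y → lf (Y + nat k) ≡ true → lf Y ≡ true
  lf-+-nat⇒lf {Y} k accY@(acc rs) free h with first-true⇒ left (Y + nat k) h
  ... | end e = first-end left Y (+-end⁻ˡ left Y (nat k) e)
  ... | move p q with ∈-+⁻ left Y (nat k) p
  ...   | optionˡ y∈ =
    first-move left Y y∈ (contraposeᵇ (rf⇒rf-+-nat k (rs (left , y∈)) (StrictlyPFree-option left free y∈)) q)
  ...   | optionʳ k∈ with nat-leftOption k k∈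
  ...     | k′ , refl , refl = StrictlyPFree⇒lf free (contraposeᵇ (rf⇒rf-+-nat k′ accY free) q)

  rf⇒rf-+-nat : ∀ {Y} k → Acc _⊏_ Y → StrictlyPFree Y → rf Y ≡ true → rf (Y + nat k) ≡ true
  rf⇒rf-+-nat {Y} k (acc rs) free h with first-true⇒ right Y h
  ... | end e = first-end right (Y + nat k) (+-end right Y (nat k) e (nat-rightEnd k))
  ... | move p q =
    first-move right (Y + nat k) (∈-+⁺ˡ right Y (nat k) p)
      (contraposeᵇ (lf-+-nat⇒lf k (rs (right , p)) (StrictlyPFree-option right free p)) q)

blockedL-end : ∀ {X} → BlockedL X → leftOpts X ≡ []
blockedL-end (blockedL _) = refl

-- Invariant: X is a blocked Left end. After a Right move in X, Left either moves in X to
-- restore it, or, if it still holds, plays in G, where she wins moving first because G is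
-- strictly 𝓟-free and Right could not win it moving first.
mutual
  lf-+-blockedL : ∀ {G X} → Acc _⊏_ G → StrictlyPFree G → BlockedL X
                → lf G ≡ true → lf (G + X) ≡ true
  lf-+-blockedL {G} {X} (acc rs) free bX h with first-true⇒ left G h
  ... | end e = first-end left (G + X) (+-end left G X e (blockedL-end bX))
  ... | move p q =
    first-move left (G + X) (∈-+⁺ˡ left G X p)
      (rf-+-blockedL (rs (left , p)) (StrictlyPFree-option left free p) bX q)

  rf-+-blockedL : ∀ {G X} → Acc _⊏_ G → StrictlyPFree G → BlockedL X
                → rf G ≡ false → rf (G + X) ≡ false
  rf-+-blockedL {G} {X} accG free bX h =
    first-false-intro right (G + X) (first-false⇒nonempty right G h ∘ +-end⁻ˡ right G X)
      (λ p → rf-+-blockedL-option accG free bX h (∈-+⁻ right G X p))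

  rf-+-blockedL-option : ∀ {G X x} → Acc _⊏_ G → StrictlyPFree G → BlockedL X → rf G ≡ false
                       → OptionOfSum right G X x → lf x ≡ true
  rf-+-blockedL-option {G} (acc rs) free bX h (optionˡ p) =
    lf-+-blockedL (rs (right , p)) (StrictlyPFree-option right free p) bX (first-false⇒ right G h p)
  rf-+-blockedL-option {G} accG free (blockedL f) h (optionʳ {x} p) with f p
  ... | inj₁ b = lf-+-blockedL accG free b (StrictlyPFree⇒lf free h)
  ... | inj₂ a with rf-+-blockedL-any accG free h a
  ...   | z , z∈ , r = first-move left (G + x) (∈-+⁺ʳ left G x z∈) r

  rf-+-blockedL-any : ∀ {G xs} → Acc _⊏_ G → StrictlyPFree G → rf G ≡ false → Any BlockedL xs
                    → ∃[ z ] z ∈ xs × rf (G + z) ≡ false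
  rf-+-blockedL-any accG free h (here b) = _ , here refl , rf-+-blockedL accG free b h
  rf-+-blockedL-any accG free h (there a) with rf-+-blockedL-any accG free h a
  ... | z , z∈ , r = z , there z∈ , r

rf-+-negsuc⇒lf : ∀ Y k → rf (Y + int -[1+ k ]) ≡ false → lf (Y + int (- pos k)) ≡ true
rf-+-negsuc⇒lf Y k h =
  first-false⇒ right (Y + int -[1+ k ]) h
    (∈-+⁺ʳ right Y (int -[1+ k ]) (subst (_∈ rightOpts (int -[1+ k ])) (conj-int (pos k)) (here refl)))

lf-leftEnd-+ : ∀ {X Y} → InPB X → leftOpts X ≡ [] → StrictlyPFree Y → lf Y ≡ true → lf (X + Y) ≡ true
lf-leftEnd-+ {X} {Y} (bX , _) e freeY h =
  trans (first-+-comm left X Y) (lf-+-blockedL (⊏-wellFounded Y) freeY (proj₁ (bX X here) e) h)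

-- Split by the sign of n: in lf-+-cancel⁺ Left's move k+1 → k swaps the roles of X and Y, and
-- only the decrease of k makes that recursion well-founded.
mutual
  lf-+-cancel⁺ : ∀ k {X Y} → Acc _⊏_ X → Acc _⊏_ Y → InPB X → InPB Y
               → lf (X + nat k) ≡ true → rf (Y + int -[1+ k ]) ≡ false → lf (X + Y) ≡ true
  lf-+-cancel⁺ k {X} {Y} accX@(acc rsX) accY pX pY h₁ h₂ with first-true⇒ left (X + nat k) h₁
  ... | end e with nat-leftEnd⁻ k (+-end⁻ʳ left X (nat k) e)
  ...   | refl =
    lf-leftEnd-+ pX (+-end⁻ˡ left X (nat 0) e) (proj₂ pY)
      (lf-+-nat⇒lf 0 accY (proj₂ pY) (rf-+-negsuc⇒lf Y 0 h₂))
  lf-+-cancel⁺ k {X} {Y} accX@(acc rsX) accY pX pY h₁ h₂ | move p q with ∈-+⁻ left X (nat k) p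
  ... | optionˡ x∈ =
    first-move left (X + Y) (∈-+⁺ˡ left X Y x∈)
      (rf-+-cancel⁺ k (rsX (left , x∈)) accY (InPB-option left pX x∈) pY q h₂)
  ... | optionʳ k∈ with nat-leftOption k k∈
  ...   | k′ , refl , refl =
    trans (first-+-comm left X Y)
      (lf-+-cancel⁻ k′ accY accX pY pX (rf-+-negsuc⇒lf Y k h₂) q)

  lf-+-cancel⁻ : ∀ k {X Y} → Acc _⊏_ X → Acc _⊏_ Y → InPB X → InPB Y
               → lf (X + int -[1+ k ]) ≡ true → rf (Y + nat k) ≡ false → lf (X + Y) ≡ true
  lf-+-cancel⁻ k {X} {Y} (acc rsX) accY pX pY h₁ h₂ with first-true⇒ left (X + int -[1+ k ]) h₁
  ... | end e =
    lf-leftEnd-+ pX (+-end⁻ˡ left X (int -[1+ k ]) e) (proj₂ pY)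
      (StrictlyPFree⇒lf (proj₂ pY) (contraposeᵇ (rf⇒rf-+-nat k accY (proj₂ pY)) h₂))
  ... | move p q with ∈-+⁻ left X (int -[1+ k ]) p
  ...   | optionˡ {x} x∈ =
    first-move left (X + Y) (∈-+⁺ˡ left X Y x∈)
      (trans (first-+-comm right x Y) (rf-+-cancel⁺ k accY (rsX (left , x∈)) pY (InPB-option left pX x∈) h₂ q))

  rf-+-cancel⁺ : ∀ k {X Y} → Acc _⊏_ X → Acc _⊏_ Y → InPB X → InPB Y
               → rf (X + nat k) ≡ false → rf (Y + int -[1+ k ]) ≡ false → rf (X + Y) ≡ false
  rf-+-cancel⁺ k {X} {Y} accX accY pX pY h₁ h₂ =
    first-false-intro right (X + Y) nonempty
      (λ p → rf-+-cancel⁺-option k accX accY pX pY h₁ h₂ (∈-+⁻ right X Y p))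
    where
    nonempty : rightOpts (X + Y) ≢ []
    nonempty e =
      first-false⇒nonempty right (X + nat k) h₁ (+-end right X (nat k) (+-end⁻ˡ right X Y e) (nat-rightEnd k))

  rf-+-cancel⁺-option : ∀ k {X Y z} → Acc _⊏_ X → Acc _⊏_ Y → InPB X → InPB Y
                      → rf (X + nat k) ≡ false → rf (Y + int -[1+ k ]) ≡ false
                      → OptionOfSum right X Y z → lf z ≡ true
  rf-+-cancel⁺-option k {X} {Y} (acc rsX) accY pX pY h₁ h₂ (optionˡ x∈) =
    lf-+-cancel⁺ k (rsX (right , x∈)) accY (InPB-option right pX x∈) pY
      (first-false⇒ right (X + nat k) h₁ (∈-+⁺ˡ right X (nat k) x∈)) h₂
  rf-+-cancel⁺-option k {X} {Y} accX (acc rsY) pX pY h₁ h₂ (optionʳ {y} y∈) =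
    trans (first-+-comm left X y)
      (lf-+-cancel⁻ k (rsY (right , y∈)) accX (InPB-option right pY y∈) pX
        (first-false⇒ right (Y + int -[1+ k ]) h₂ (∈-+⁺ˡ right Y (int -[1+ k ]) y∈)) h₁)

lf-+-cancel : ∀ n {X Y} → InPB X → InPB Y → lf (X + int n) ≡ true → rf (Y + int (mirror n)) ≡ false
            → lf (X + Y) ≡ true
lf-+-cancel (pos k) {X} {Y} = lf-+-cancel⁺ k (⊏-wellFounded X) (⊏-wellFounded Y)
lf-+-cancel -[1+ k ] {X} {Y} = lf-+-cancel⁻ k (⊏-wellFounded X) (⊏-wellFounded Y)

-- Closure under sums

last-true : (u : ℕ → Bool) → u 0 ≡ true → ∀ d → (∀ j → d ℕ.≤ j → u j ≡ false)
          → ∃[ j ] u j ≡ true × (∀ i → j ℕ.< i → u i ≡ false)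
last-true u u₀ zero beyond with trans (sym u₀) (beyond 0 ℕ.z≤n)
... | ()
last-true u u₀ (suc d) beyond with u d in e
... | true = d , e , beyond
... | false = last-true u u₀ d beyond′
  where
  beyond′ : ∀ j → d ℕ.≤ j → u j ≡ false
  beyond′ j d≤j with ℕ.m≤n⇒m<n∨m≡n d≤j
  ... | inj₁ d<j = beyond j d<j
  ... | inj₂ refl = e

lf-+-int-threshold : ∀ G → ∃[ n ] lf (G + int n) ≡ true × lf (G + int (ℤ.suc (ℤ.suc n))) ≡ false
lf-+-int-threshold G =
  let j , uj , after = last-true u u₀ (suc s ℕ.+ suc s) beyond
  in pos j ℤ.+ -[1+ s ] , uj ,
     subst (λ m → lf (G + int m) ≡ false) (shift j) (after (2 ℕ.+ j) (ℕ.s≤s (ℕ.n≤1+n j)))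
  where
  s : ℕ
  s = size G
  u : ℕ → Bool
  u j = lf (G + int (pos j ℤ.+ -[1+ s ]))
  u₀ : u 0 ≡ true
  u₀ = subst (λ m → lf (G + int m) ≡ true) (sym (ℤ.+-identityˡ -[1+ s ]))
         (lf-+-conj-nat-large (suc s) (ℕ.n≤1+n s))
  beyond : ∀ j → suc s ℕ.+ suc s ℕ.≤ j → u j ≡ false
  beyond j le = subst (λ m → lf (G + int m) ≡ false) (sym (ℤ.⊖-≥ (ℕ.m+n≤o⇒n≤o (suc s) le)))
    (lf-+-nat-large (j ℕ.∸ suc s) (⊏-wellFounded G) (ℕ.m+n≤o⇒m≤o∸n (suc s) le))
  shift : ∀ j → pos (2 ℕ.+ j) ℤ.+ -[1+ s ] ≡ ℤ.suc (ℤ.suc (pos j ℤ.+ -[1+ s ]))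
  shift j = trans (ℤ.suc-+ (suc j) -[1+ s ]) (cong ℤ.suc (ℤ.suc-+ j -[1+ s ]))

lf⊎rf-+ : ∀ {G H} → InPB G → InPB H → lf (G + H) ≡ true ⊎ rf (G + H) ≡ true
lf⊎rf-+ {G} {H} pG pH with lf-+-int-threshold G
... | n , h₀ , h₂ with rf (H + int (mirror n)) in r
...   | false = inj₁ (lf-+-cancel n pG pH h₀ r)
...   | true = inj₂ (trans (first-+-comm right G H)
                      (trans (sym (first-conj-+ left H G))
                        (lf-+-cancel (ℤ.suc n) (InPB-conj pH) (InPB-conj pG) hH hG)))
  where
  hH : lf (conj H + int (ℤ.suc n)) ≡ true
  hH = trans (cong (λ Z → lf (conj H + Z)) (sym (conj-int-mirror n)))
         (trans (first-conj-+ left H (int (mirror n))) r)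
  hG : rf (conj G + int (mirror (ℤ.suc n))) ≡ false
  hG = trans (cong (λ Z → rf (conj G + Z)) (int-mirror-suc n))
         (trans (first-conj-+ right G (int (ℤ.suc (ℤ.suc n)))) h₂)

InPB-+ : ∀ G H → InPB G → InPB H → InPB (G + H)
InPB-+ G H pG pH = Blocking-+ (proj₁ pG) (proj₁ pH) , free
  where
  free : StrictlyPFree (G + H)
  free S p with ≼-+⁻ p
  ... | _⊕_ {a} {b} a≼G b≼H = outcome≢𝓟 (a + b) (lf⊎rf-+ (InPB-≼ pG a≼G) (InPB-≼ pH b≼H))

≥o-trans : ∀ {a b c} → a ≥o b → b ≥o c → a ≥o c
≥o-trans refl≥ q = q
≥o-trans 𝓛≥ _ = 𝓛≥
≥o-trans ≥𝓡 refl≥ = ≥𝓡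
≥o-trans ≥𝓡 ≥𝓡 = ≥𝓡

≥B-trans : ∀ {A B C} → A ≥B B → B ≥B C → A ≥B C
≥B-trans A≥B B≥C X bX = ≥o-trans (A≥B X bX) (B≥C X bX)

≥B-resp-≅ : ∀ {G G′ H H′} → G ≅ G′ → H ≅ H′ → G ≥B H → G′ ≥B H′
≥B-resp-≅ G≅G′ H≅H′ G≥H X bX =
  subst₂ _≥o_ (outcome-≅ (+-cong G≅G′ (≅-refl X))) (outcome-≅ (+-cong H≅H′ (≅-refl X))) (G≥H X bX)

+-monoˡ-≥B : ∀ G A H → Blocking H → G ≥B A → (G + H) ≥B (A + H)
+-monoˡ-≥B G A H bH G≥A X bX =
  subst₂ _≥o_ (sym (outcome-≅ (+-assoc-≅ G H X))) (sym (outcome-≅ (+-assoc-≅ A H X)))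
    (G≥A (H + X) (Blocking-+ bH bX))

+-mono-≥B : ∀ G H A B → Blocking H → Blocking A → G ≥B A → H ≥B B → (G + H) ≥B (A + B)
+-mono-≥B G H A B bH bA G≥A H≥B =
  ≥B-trans {G + H} {A + H} {A + B} (+-monoˡ-≥B G A H bH G≥A)
    (≥B-resp-≅ (+-comm-≅ H A) (+-comm-≅ B A) (+-monoˡ-≥B H B A bA H≥B))

InPBmodB-+ : ∀ G H → InPBmodB G → InPBmodB H → InPBmodB (G + H)
InPBmodB-+ G H (bG , A , bA , fA , G≥A , A≥G) (bH , B , bB , fB , H≥B , B≥H) =
  let bAB , fAB = InPB-+ A B (bA , fA) (bB , fB)
  in Blocking-+ bG bH , A + B , bAB , fAB ,
     +-mono-≥B G H A B bH bA G≥A H≥B , +-mono-≥B A B G H bB bG A≥G B≥H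

theorem4p9 : ((G H : Game) → InPB G → InPB H → InPB (G + H))
    × ((G H : Game) → InPBmodB G → InPBmodB H → InPBmodB (G + H))
theorem4p9 = InPB-+ , InPBmodB-+
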